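{- Let $k\geq 1$ and let $G$ be a connected graph such that $\operatorname{rad}(G)\leq k$ or $\operatorname{diam}(G)=k+1$. Then $\dim(G)\leq \gamma^r_k(G)\leq \dim(G)+1$.
   Context: For a graph $G=(V,E)$, the eccentricity of a vertex is its maximum distance to any other vertex; $\operatorname{diam}(G)$ and $\operatorname{rad}(G)$ are the maximum and minimum eccentricity. For $k\geq 1$, a set $D\subseteq V$ is distance $k$-dominating if every $v\in V\setminus D$ is at distance at most $k$ from some vertex of $D$. An ordered set $W=\{w_1,\dots,w_r\}$ is a resolving set if for all distinct $u,v\in V\setminus W$ the distance vectors $(d_G(u,w_i))_i$ and $(d_G(v,w_i))_i$ differ; $\dim(G)$ is the minimum size of a resolving set. $\gamma^r_k(G)$ is the minimum cardinality of a set that is both resolving and distance $k$-dominating. -}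

module Defs where

open import Data.Nat using (ℕ; zero; suc; _≤_)
open import Data.Fin using (Fin)
open import Data.Fin.Subset using (Subset; _∈_; _∉_; ∣_∣)
open import Data.Bool using (Bool; true; false)
open import Data.Product using (Σ; ∃; ∃-syntax; _×_; _,_)
open import Relation.Binary.PropositionalEquality using (_≡_; _≢_)
open import Relation.Nullary using (¬_)

record Graph (n : ℕ) : Set where
  field
    adj    : Fin n → Fin n → Bool
    adj-sym : ∀ u v → adj u v ≡ adj v u
    adj-irr : ∀ v → adj v v ≡ false

open Graph public

module _ {n : ℕ} (G : Graph n) where

  data Walk : Fin n → Fin n → ℕ → Set where
    nil  : ∀ {v} → Walk v v zero
    cons : ∀ {u w v m} → adj G u w ≡ true → Walk w v m → Walk u v (suc m)

  Connected : Set
  Connected = ∀ u v → ∃[ m ] Walk u v m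

  Dist : Fin n → Fin n → ℕ → Set
  Dist u v m = Walk u v m × (∀ m' → Walk u v m' → m ≤ m')

  Ecc : Fin n → ℕ → Set
  Ecc v e = (∀ u m → Dist v u m → m ≤ e) × (∃[ u ] Dist v u e)

  Rad : ℕ → Set
  Rad r = (∃[ v ] Ecc v r) × (∀ v e → Ecc v e → r ≤ e)

  Diam : ℕ → Set
  Diam d = (∃[ v ] Ecc v d) × (∀ v e → Ecc v e → e ≤ d)

  Resolving : Subset n → Set
  Resolving W = ∀ u v → u ∉ W → v ∉ W → u ≢ v →
    ∃[ w ] (w ∈ W × ∃[ a ] ∃[ b ] (Dist u w a × Dist v w b × a ≢ b))

  KDominating : ℕ → Subset n → Set
  KDominating k D = ∀ v → v ∉ D → ∃[ w ] (w ∈ D × ∃[ m ] (Dist v w m × m ≤ k))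

  MetricDim : ℕ → Set
  MetricDim d = (∃[ W ] (Resolving W × ∣ W ∣ ≡ d))
              × (∀ W → Resolving W → d ≤ ∣ W ∣)

  GammaRK : ℕ → ℕ → Set
  GammaRK k g = (∃[ S ] (Resolving S × KDominating k S × ∣ S ∣ ≡ g))
              × (∀ S → Resolving S → KDominating k S → g ≤ ∣ S ∣)

{-# OPTIONS --safe #-}
module Submission where

-- A resolving k-dominating set is resolving, so dim ≤ γʳₖ. Conversely, a metric
-- basis W becomes k-dominating after adding at most one vertex. If rad ≤ k, add a
-- centre. If diam = k + 1, a vertex outside W at distance > k from all of W is at
-- distance exactly k + 1 from each of them; since W is resolving, there is at most
-- one such vertex, and we add it.

open import Defs
open import Data.Nat using (ℕ; zero; suc; _≤_; _<_; _+_; _≤?_; _<?_; z≤n; s≤s)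
open import Data.Nat.Properties
  using (≤-trans; ≤-antisym; ≤-reflexive; n≤1+n; m≤m+n; +-suc; +-comm; +-monoʳ-≤; ≮⇒≥; ≰⇒>; m<1+n⇒m<n∨m≡n)
open import Data.Fin using (Fin) renaming (_≟_ to _≟ᶠ_)
open import Data.Fin.Subset using (Subset; _∈_; _∉_; ∣_∣; _∪_; ⁅_⁆; _⊆_; inside; outside)
open import Data.Fin.Subset.Properties using (_∈?_; ∣⁅x⁆∣≡1; p⊆p∪q; x∈p∪q⁺; x∈⁅x⁆)
open import Data.Fin.Properties using (any?; all?)
open import Data.Bool.Properties using () renaming (_≟_ to _≟ᵇ_)
open import Data.List using (allFin)
open import Data.List.Extrema.Nat using (argmax; f[xs]≤f[argmax])
open import Data.List.Membership.Propositional.Properties using (∈-allFin)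
import Data.List.Relation.Unary.All as All
open import Data.Bool using (true)
open import Data.Vec using (_∷_; [])
open import Data.Product using (∃-syntax; _×_; _,_; proj₁; proj₂)
open import Data.Sum using (_⊎_; inj₁; inj₂)
open import Relation.Nullary using (¬_; Dec; yes; no; contradiction)
open import Relation.Nullary.Decidable using (_×-dec_; _→-dec_; ¬?; decidable-stable)
open import Relation.Unary using (Decidable)
open import Relation.Binary.PropositionalEquality using (module ≡-Reasoning; _≡_; refl; sym; trans; subst)
open ≡-Reasoning
open import Function using (id)

least-witness : ∀ {p} {P : ℕ → Set p} → Decidable P → ∀ {M} → P M →
                ∃[ m ] (P m × ∀ m′ → P m′ → m ≤ m′)
least-witness {P = P} P? {M} pM = search 0 M (λ ()) (subst P (sym (+-comm M 0)) pM)
  where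
  search : ∀ j t → (∀ {m} → m < j → ¬ P m) → P (t + j) →
           ∃[ m ] (P m × ∀ m′ → P m′ → m ≤ m′)
  search j t below p with P? j
  ... | yes pj = j , pj , λ m′ pm′ → ≮⇒≥ (λ m′<j → below m′<j pm′)
  search j zero    below p | no ¬pj = contradiction p ¬pj
  search j (suc t) below p | no ¬pj = search (suc j) t below′ (subst P (sym (+-suc t j)) p)
    where
    below′ : ∀ {m} → m < suc j → ¬ P m
    below′ m<1+j with m<1+n⇒m<n∨m≡n m<1+j
    ... | inj₁ m<j  = below m<j
    ... | inj₂ refl = ¬pj

∣p∪q∣≤∣p∣+∣q∣ : ∀ {n} (p q : Subset n) → ∣ p ∪ q ∣ ≤ ∣ p ∣ + ∣ q ∣
∣p∪q∣≤∣p∣+∣q∣ []            []            = z≤n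
∣p∪q∣≤∣p∣+∣q∣ (inside  ∷ p) (inside  ∷ q) =
  s≤s (≤-trans (∣p∪q∣≤∣p∣+∣q∣ p q) (+-monoʳ-≤ ∣ p ∣ (n≤1+n ∣ q ∣)))
∣p∪q∣≤∣p∣+∣q∣ (inside  ∷ p) (outside ∷ q) = s≤s (∣p∪q∣≤∣p∣+∣q∣ p q)
∣p∪q∣≤∣p∣+∣q∣ (outside ∷ p) (inside  ∷ q) =
  ≤-trans (s≤s (∣p∪q∣≤∣p∣+∣q∣ p q)) (≤-reflexive (sym (+-suc ∣ p ∣ ∣ q ∣)))
∣p∪q∣≤∣p∣+∣q∣ (outside ∷ p) (outside ∷ q) = ∣p∪q∣≤∣p∣+∣q∣ p q

∣p∪⁅x⁆∣≤∣p∣+1 : ∀ {n} (p : Subset n) (x : Fin n) → ∣ p ∪ ⁅ x ⁆ ∣ ≤ ∣ p ∣ + 1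
∣p∪⁅x⁆∣≤∣p∣+1 p x = subst (λ c → ∣ p ∪ ⁅ x ⁆ ∣ ≤ ∣ p ∣ + c) (∣⁅x⁆∣≡1 x) (∣p∪q∣≤∣p∣+∣q∣ p ⁅ x ⁆)

module _ {n : ℕ} (G : Graph n) where

  walk-snoc : ∀ {u v w m} → Walk G u v m → adj G v w ≡ true → Walk G u w (suc m)
  walk-snoc nil        e = cons e nil
  walk-snoc (cons f p) e = cons f (walk-snoc p e)

  walk-reverse : ∀ {u v m} → Walk G u v m → Walk G v u m
  walk-reverse nil                        = nil
  walk-reverse (cons {u = u} {w = w} e p) = walk-snoc (walk-reverse p) (trans (adj-sym G w u) e)

  walk? : ∀ m u v → Dec (Walk G u v m)
  walk? zero u v with u ≟ᶠ v
  ... | yes refl = yes nil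
  ... | no u≢v   = no λ { nil → u≢v refl }
  walk? (suc m) u v with any? (λ w → (adj G u w ≟ᵇ true) ×-dec walk? m w v)
  ... | yes (w , e , p) = yes (cons e p)
  ... | no ∄w           = no λ { (cons {w = w} e p) → ∄w (w , e , p) }

  walk⇒dist : ∀ {u v m} → Walk G u v m → ∃[ d ] Dist G u v d
  walk⇒dist {u} {v} = least-witness (λ m → walk? m u v)

  dist-sym : ∀ {u v m} → Dist G u v m → Dist G v u m
  dist-sym (p , minimal) = walk-reverse p , λ m′ q → minimal m′ (walk-reverse q)

  dist-unique : ∀ {u v a b} → Dist G u v a → Dist G u v b → a ≡ b
  dist-unique (p , minimal-a) (q , minimal-b) = ≤-antisym (minimal-a _ q) (minimal-b _ p)

  resolving-⊆ : ∀ {W T} → W ⊆ T → Resolving G W → Resolving G T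
  resolving-⊆ W⊆T resW u v u∉T v∉T u≢v
    with resW u v (λ u∈W → u∉T (W⊆T u∈W)) (λ v∈W → v∉T (W⊆T v∈W)) u≢v
  ... | w , w∈W , distinguishes = w , W⊆T w∈W , distinguishes

  DominatingSuperset : ℕ → Subset n → Set
  DominatingSuperset k W = ∃[ T ] (W ⊆ T × ∣ T ∣ ≤ ∣ W ∣ + 1 × KDominating G k T)

  module _ (connected : Connected G) where

    dist : ∀ u v → ∃[ m ] Dist G u v m
    dist u v = walk⇒dist (proj₂ (connected u v))

    δ : Fin n → Fin n → ℕ
    δ u v = proj₁ (dist u v)

    δ-dist : ∀ u v → Dist G u v (δ u v)
    δ-dist u v = proj₂ (dist u v)

    farthest : Fin n → Fin n
    farthest u = argmax (δ u) u (allFin n)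

    δ≤δ-farthest : ∀ u v → δ u v ≤ δ u (farthest u)
    δ≤δ-farthest u v = All.lookup (f[xs]≤f[argmax] u (allFin n)) (∈-allFin v)

    ecc-farthest : ∀ u → Ecc G u (δ u (farthest u))
    ecc-farthest u =
      (λ v m dist-m → subst (_≤ δ u (farthest u)) (dist-unique (δ-dist u v) dist-m)
                              (δ≤δ-farthest u v)) ,
      farthest u , δ-dist u (farthest u)

    δ≤diam : ∀ {D} → Diam G D → ∀ u v → δ u v ≤ D
    δ≤diam (_ , ecc≤D) u v = ≤-trans (δ≤δ-farthest u v) (ecc≤D u _ (ecc-farthest u))

    center-kDominating : ∀ {c e k D} → c ∈ D → Ecc G c e → e ≤ k → KDominating G k D
    center-kDominating {c} c∈D (ecc≤e , _) e≤k v _ =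
      c , c∈D , δ c v , dist-sym (δ-dist c v) , ≤-trans (ecc≤e v (δ c v) (δ-dist c v)) e≤k

    Far : ℕ → Subset n → Fin n → Set
    Far k W x = x ∉ W × (∀ w → w ∈ W → k < δ x w)

    far? : ∀ k W → Decidable (Far k W)
    far? k W x = ¬? (x ∈? W) ×-dec all? (λ w → (w ∈? W) →-dec (k <? δ x w))

    kDominating-⊇-far : ∀ {k W T} → W ⊆ T → (∀ x → Far k W x → x ∈ T) → KDominating G k T
    kDominating-⊇-far {k} {W} W⊆T far⊆T v v∉T with any? (λ w → (w ∈? W) ×-dec (δ v w ≤? k))
    ... | yes (w , w∈W , δ≤k) = w , W⊆T w∈W , δ v w , δ-dist v w , δ≤k
    ... | no ∄near = contradiction (far⊆T v v-far) v∉T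
      where
      v-far : Far k W v
      v-far = (λ v∈W → v∉T (W⊆T v∈W)) , λ w w∈W → ≰⇒> (λ δ≤k → ∄near (w , w∈W , δ≤k))

    far-unique : ∀ {k W x y} → Resolving G W → (∀ u v → δ u v ≤ suc k) →
                 Far k W x → Far k W y → x ≡ y
    far-unique {k} {W} {x} {y} resW δ≤1+k (x∉W , x-far) (y∉W , y-far) =
      decidable-stable (x ≟ᶠ y) λ x≢y →
      let w , w∈W , a , b , dist-a , dist-b , a≢b = resW x y x∉W y∉W x≢y in
      a≢b (begin
        a         ≡⟨ dist-unique (δ-dist x w) dist-a ⟨
        δ x w     ≡⟨ at-diameter x w (x-far w w∈W) ⟩
        suc k     ≡⟨ at-diameter y w (y-far w w∈W) ⟨
        δ y w     ≡⟨ dist-unique (δ-dist y w) dist-b ⟩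
        b         ∎)
      where
      at-diameter : ∀ u w → k < δ u w → δ u w ≡ suc k
      at-diameter u w k<δ = ≤-antisym (δ≤1+k u w) k<δ

    center-dominatingSuperset : ∀ {c e k} W → Ecc G c e → e ≤ k → DominatingSuperset k W
    center-dominatingSuperset {c} W ecc e≤k =
      W ∪ ⁅ c ⁆ , p⊆p∪q ⁅ c ⁆ , ∣p∪⁅x⁆∣≤∣p∣+1 W c ,
      center-kDominating (x∈p∪q⁺ (inj₂ (x∈⁅x⁆ c))) ecc e≤k

    diam-dominatingSuperset : ∀ {k W} → Resolving G W → Diam G (suc k) → DominatingSuperset k W
    diam-dominatingSuperset {k} {W} resW diam with any? (far? k W)
    ... | yes (x , x-far) =
      W ∪ ⁅ x ⁆ , p⊆p∪q ⁅ x ⁆ , ∣p∪⁅x⁆∣≤∣p∣+1 W x , kDominating-⊇-far (p⊆p∪q ⁅ x ⁆) far⊆W∪x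
      where
      far⊆W∪x : ∀ y → Far k W y → y ∈ W ∪ ⁅ x ⁆
      far⊆W∪x y y-far =
        subst (_∈ W ∪ ⁅ x ⁆) (far-unique resW (δ≤diam diam) x-far y-far) (x∈p∪q⁺ (inj₂ (x∈⁅x⁆ x)))
    ... | no ∄far =
      W , id , m≤m+n ∣ W ∣ 1 , kDominating-⊇-far id (λ y y-far → contradiction (y , y-far) ∄far)

proposition2p4 : ∀ {n : ℕ} (G : Graph n) (k : ℕ) → 1 ≤ k → Connected G →
    ((∃[ r ] (Rad G r × r ≤ k)) ⊎ Diam G (suc k)) →
    ∀ d g → MetricDim G d → GammaRK G k g →
    d ≤ g × g ≤ d + 1
proposition2p4 G k _ connected hyp d g
               ((W , resW , ∣W∣≡d) , dim-minimal) ((S , resS , _ , ∣S∣≡g) , γ-minimal) =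
  subst (d ≤_) ∣S∣≡g (dim-minimal S resS) , γ≤ (superset hyp)
  where
  superset : ((∃[ r ] (Rad G r × r ≤ k)) ⊎ Diam G (suc k)) → DominatingSuperset G k W
  superset (inj₁ (r , ((c , ecc) , _) , r≤k)) = center-dominatingSuperset G connected W ecc r≤k
  superset (inj₂ diam)                        = diam-dominatingSuperset G connected resW diam

  γ≤ : DominatingSuperset G k W → g ≤ d + 1
  γ≤ (T , W⊆T , ∣T∣≤ , domT) =
    ≤-trans (γ-minimal T (resolving-⊆ G W⊆T resW) domT)
            (subst (λ m → ∣ T ∣ ≤ m + 1) ∣W∣≡d ∣T∣≤)
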